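{- Let $k$ and $n$ be positive integers. The hypercube $Q_k$ divides the hypercube $Q_n$ if and only if $k$ divides $n$.
   Context: $Q_n$ is the $n$-dimensional hypercube: vertex set the subsets of $\{1,\ldots,n\}$, with $x,y$ adjacent iff $|x\,\Delta\, y|=1$. If $H$ is isomorphic to a subgraph of $G$, $H$ divides $G$ if there exist embeddings $\theta_1,\ldots,\theta_r$ of $H$ into $G$ such that $\{E(\theta_1(H)),\ldots,E(\theta_r(H))\}$ is a partition of $E(G)$. -}

module Defs where

open import Data.Nat using (ℕ; _≡ᵇ_)
open import Data.Fin using (Fin)
open import Data.Fin.Subset using (Subset; _∪_; _─_; ∣_∣)
open import Data.Product using (Σ; ∃; ∃-syntax; _×_)
open import Relation.Binary.PropositionalEquality using (_≡_)
open import Function.Definitions using (Injective)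
open import Level using (0ℓ; suc)

record Graph : Set₁ where
  field
    V   : Set
    Adj : V → V → Set

open Graph public

_Δ_ : ∀ {n} → Subset n → Subset n → Subset n
x Δ y = (x ─ y) ∪ (y ─ x)

Q : ℕ → Graph
Q n = record { V = Subset n ; Adj = λ x y → ∣ x Δ y ∣ ≡ 1 }

-- An embedding of H into G: an injective vertex map preserving adjacency
-- (i.e. an isomorphism of H onto a subgraph of G).
record Embedding (H G : Graph) : Set where
  field
    map     : V H → V G
    inj     : Injective _≡_ _≡_ map
    adj-pres : ∀ {u v} → Adj H u v → Adj G (map u) (map v)

open Embedding public

-- The (ordered representative of the) edge xy of G lies in E(θ(H)).
InImage : ∀ {H G} → Embedding H G → V G → V G → Set
InImage {H} θ x y = ∃[ u ] ∃[ v ] (Adj H u v × map θ u ≡ x × map θ v ≡ y)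

-- H divides G: there are embeddings θ₁,…,θᵣ whose edge sets partition E(G),
-- i.e. every edge of G lies in the image of exactly one θᵢ, and every
-- image edge is an edge of G (automatic from adjacency preservation).
Divides : Graph → Graph → Set
Divides H G =
  ∃[ r ] Σ (Fin r → Embedding H G) λ θ →
    ∀ x y → Adj G x y →
      ∃[ i ] (InImage (θ i) x y × (∀ j → InImage (θ j) x y → j ≡ i))

module Submission where

-- Writing a vertex of Q (m + n) as a concatenation a ++ c,
-- an edge changes exactly one of the two blocks.  Hence a partition of
-- E(Q m) into copies of Q k and one of E(Q n) combine into a partition of
-- E(Q (m + n)): glue each copy in Q m to every fixed second block, and each
-- copy in Q n to every fixed first block ('divides-+').  Starting from the
-- edgeless Q 0 and adding the trivial partition of Q k into itself gives
-- Q k ∣ Q (q * k) for every q.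
--
-- Fix a vertex x of Q n and a partition θ₁ … θᵣ.  Label the
-- direction t of each of the n edges at x by the pair (i , s): θᵢ is the copy
-- containing the edge and s is its direction inside that copy of Q k.  The
-- labelling is injective, and a copy meeting x meets it in all k directions,
-- so its image is a union of full rows of Fin r × Fin k; counting rows
-- gives k ∣ n ('RowCounting').

open import Defs
open import Data.Nat using (ℕ; zero; suc; _+_; _*_; _≤_; pred)
open import Data.Nat.Divisibility using (_∣_; divides; ∣m∣n⇒∣m+n; ∣-refl; _∣0)
open import Data.Bool using (true; false; not)
open import Data.Fin using (Fin; zero; suc; _≟_)
open import Data.Fin.Properties
  using (1↔⊤; 2↔Bool; +↔⊎; *↔×; any?; cantor-schröder-bernstein)
open import Data.Fin.Subset using (Subset; ∣_∣)
open import Data.Vec using ([]; _∷_; _++_; replicate; updateAt; splitAt; tail)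
open import Data.Vec.Properties using (++-injectiveˡ; ++-injectiveʳ)
open import Data.Vec.Functional using (foldr)
open import Data.Product using (Σ; _×_; _,_; proj₁; proj₂)
open import Data.Sum using (_⊎_; inj₁; inj₂)
open import Data.Unit using (⊤; tt)
open import Data.Empty using (⊥-elim)
open import Function using (_∘_)
open import Function.Bundles using (_⇔_; mk⇔; _↔_; Inverse; Injection; mk↔ₛ′)
open import Function.Properties.Inverse using (↔-refl; ↔-trans; ↔-sym; ↔⇒↣)
open import Data.Sum.Function.Propositional using (_⊎-↔_)
open import Data.Product.Function.NonDependent.Propositional using (_×-↔_)
open import Relation.Nullary using (Dec; yes; no; ¬_)
open import Relation.Binary.PropositionalEquality
import Axiom.UniquenessOfIdentityProofs as UIP

open Inverse using (to; from; strictlyInverseˡ; strictlyInverseʳ)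

Finite : Set → Set
Finite T = Σ ℕ λ r → Fin r ↔ T

finite-Fin : ∀ r → Finite (Fin r)
finite-Fin r = r , ↔-refl

finite-⊤ : Finite ⊤
finite-⊤ = 1 , 1↔⊤

finite-⊎ : ∀ {A B} → Finite A → Finite B → Finite (A ⊎ B)
finite-⊎ (a , e) (b , f) = a + b , ↔-trans +↔⊎ (e ⊎-↔ f)

finite-× : ∀ {A B} → Finite A → Finite B → Finite (A × B)
finite-× (a , e) (b , f) = a * b , ↔-trans *↔× (e ×-↔ f)

finite-Subset : ∀ n → Finite (Subset n)
finite-Subset zero = 1 , mk↔ₛ′ (λ _ → []) (λ _ → zero) (λ { [] → refl }) (λ { zero → refl })
finite-Subset (suc n) =
  2 * proj₁ (finite-Subset n) ,
  ↔-trans *↔× (↔-trans (2↔Bool ×-↔ proj₂ (finite-Subset n)) cons↔)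
  where
  cons↔ : _
  cons↔ = mk↔ₛ′ (λ (b , x) → b ∷ x) (λ { (b ∷ x) → b , x })
                (λ { (b ∷ x) → refl }) (λ { (b , x) → refl })

cardinality-unique : ∀ {m n} → Fin m ↔ Fin n → m ≡ n
cardinality-unique e =
  cantor-schröder-bernstein (Injection.injective (↔⇒↣ e)) (Injection.injective (↔⇒↣ (↔-sym e)))

sumFin : ∀ {r} → (Fin r → ℕ) → ℕ
sumFin = foldr _+_ 0

Σ-Fin-↔ : ∀ {r} (F : Fin r → Set) (c : Fin r → ℕ) →
          (∀ i → F i ↔ Fin (c i)) → Σ (Fin r) F ↔ Fin (sumFin c)
Σ-Fin-↔ {zero} F c e = mk↔ₛ′ (λ { (() , _) }) (λ ()) (λ ()) (λ { (() , _) })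
Σ-Fin-↔ {suc r} F c e =
  ↔-trans split (↔-trans (e zero ⊎-↔ Σ-Fin-↔ (F ∘ suc) (c ∘ suc) (e ∘ suc)) (↔-sym +↔⊎))
  where
  split : Σ (Fin (suc r)) F ↔ (F zero ⊎ Σ (Fin r) (F ∘ suc))
  split = mk↔ₛ′ (λ { (zero , x) → inj₁ x ; (suc i , x) → inj₂ (i , x) })
                (λ { (inj₁ x) → zero , x ; (inj₂ (i , x)) → suc i , x })
                (λ { (inj₁ x) → refl ; (inj₂ (i , x)) → refl })
                (λ { (zero , x) → refl ; (suc i , x) → refl })

∣-sumFin : ∀ {k r} (c : Fin r → ℕ) → (∀ i → k ∣ c i) → k ∣ sumFin c
∣-sumFin {k} {zero} c d = k ∣0
∣-sumFin {k} {suc r} c d = ∣m∣n⇒∣m+n (d zero) (∣-sumFin (c ∘ suc) (d ∘ suc))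

fibres-↔ : ∀ {A B : Set} (g : A → B) → A ↔ Σ B (λ b → Σ A λ a → g a ≡ b)
fibres-↔ g = mk↔ₛ′ (λ a → g a , a , refl) (λ (b , a , p) → a)
                   (λ { (b , a , refl) → refl }) (λ a → refl)

-- An injection Fin n → Fin r × Fin k whose image is a union of full rows
-- {i} × Fin k forces k ∣ n: every fibre of the row map has size 0 or k.
module RowCounting {n r k : ℕ} (label : Fin n → Fin r × Fin k)
  (label-injective : ∀ {t t'} → label t ≡ label t' → t ≡ t')
  (rows-full : ∀ t s → Σ (Fin n) λ t' → label t' ≡ (proj₁ (label t) , s)) where

  row : Fin n → Fin r
  row = proj₁ ∘ label

  Fibre : Fin r → Set
  Fibre i = Σ (Fin n) λ t → row t ≡ i

  -- Proofs of equalities in Fin are unique, so fibre elements are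
  -- determined by their first component.
  fibre-≡ : ∀ {i t t'} (p : row t ≡ i) (p' : row t' ≡ i) → t ≡ t' → _≡_ {A = Fibre i} (t , p) (t' , p')
  fibre-≡ p p' refl = cong (_ ,_) (UIP.Decidable⇒UIP.≡-irrelevant _≟_ p p')

  full-fibre : ∀ {i} → Fibre i → Fibre i ↔ Fin k
  full-fibre {i} (t₀ , p₀) = mk↔ₛ′ (λ (t , _) → proj₂ (label t)) back
    (λ s → cong proj₂ (proj₂ (rows-full t₀ s)))
    (λ (t , p) → fibre-≡ _ p (label-injective (label-back t p)))
    where
    back : Fin k → Fibre i
    back s = proj₁ (rows-full t₀ s) , trans (cong proj₁ (proj₂ (rows-full t₀ s))) p₀
    label-back : ∀ t → row t ≡ i → label (proj₁ (back (proj₂ (label t)))) ≡ label t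
    label-back t p = trans (proj₂ (rows-full t₀ (proj₂ (label t))))
                           (cong (_, proj₂ (label t)) (trans p₀ (sym p)))

  fibreSize : ∀ {i} → Dec (Fibre i) → ℕ
  fibreSize (yes _) = k
  fibreSize (no _) = 0

  fibreSize-↔ : ∀ {i} (d : Dec (Fibre i)) → Fibre i ↔ Fin (fibreSize d)
  fibreSize-↔ (yes f) = full-fibre f
  fibreSize-↔ (no ¬f) = mk↔ₛ′ (λ f → ⊥-elim (¬f f)) (λ ()) (λ ()) (λ f → ⊥-elim (¬f f))

  k∣fibreSize : ∀ {i} (d : Dec (Fibre i)) → k ∣ fibreSize d
  k∣fibreSize (yes _) = ∣-refl
  k∣fibreSize (no _) = k ∣0

  k∣n : k ∣ n
  k∣n = subst (k ∣_) (sym (cardinality-unique counting)) (∣-sumFin _ (k∣fibreSize ∘ decide))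
    where
    decide : ∀ i → Dec (Fibre i)
    decide i = any? (λ t → row t ≟ i)
    counting : Fin n ↔ Fin (sumFin (fibreSize ∘ decide))
    counting = ↔-trans (fibres-↔ row) (Σ-Fin-↔ Fibre _ (fibreSize-↔ ∘ decide))

flipAt : ∀ {n} → Subset n → Fin n → Subset n
flipAt x s = updateAt x s not

distance-++ : ∀ {m n} (a b : Subset m) (c d : Subset n) →
              ∣ (a ++ c) Δ (b ++ d) ∣ ≡ ∣ a Δ b ∣ + ∣ c Δ d ∣
distance-++ [] [] c d = refl
distance-++ (true ∷ a) (true ∷ b) c d = distance-++ a b c d
distance-++ (true ∷ a) (false ∷ b) c d = cong suc (distance-++ a b c d)
distance-++ (false ∷ a) (true ∷ b) c d = cong suc (distance-++ a b c d)
distance-++ (false ∷ a) (false ∷ b) c d = distance-++ a b c d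

distance-self : ∀ {n} (x : Subset n) → ∣ x Δ x ∣ ≡ 0
distance-self [] = refl
distance-self (true ∷ x) = distance-self x
distance-self (false ∷ x) = distance-self x

distance-zero⇒≡ : ∀ {n} (x y : Subset n) → ∣ x Δ y ∣ ≡ 0 → x ≡ y
distance-zero⇒≡ [] [] _ = refl
distance-zero⇒≡ (true ∷ x) (true ∷ y) e = cong (true ∷_) (distance-zero⇒≡ x y e)
distance-zero⇒≡ (false ∷ x) (false ∷ y) e = cong (false ∷_) (distance-zero⇒≡ x y e)

adjacent-irreflexive : ∀ {n} {x y : Subset n} → Adj (Q n) x y → x ≢ y
adjacent-irreflexive {x = x} a refl with trans (sym (distance-self x)) a
... | ()

flip-adjacent : ∀ {n} (x : Subset n) (s : Fin n) → Adj (Q n) x (flipAt x s)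
flip-adjacent (true ∷ x) zero = cong suc (distance-self x)
flip-adjacent (false ∷ x) zero = cong suc (distance-self x)
flip-adjacent (true ∷ x) (suc s) = flip-adjacent x s
flip-adjacent (false ∷ x) (suc s) = flip-adjacent x s

adjacent⇒flip : ∀ {n} (x y : Subset n) → Adj (Q n) x y → Σ (Fin n) λ s → y ≡ flipAt x s
adjacent⇒flip [] [] ()
adjacent⇒flip (true ∷ x) (true ∷ y) a = let (s , p) = adjacent⇒flip x y a in suc s , cong (true ∷_) p
adjacent⇒flip (false ∷ x) (false ∷ y) a = let (s , p) = adjacent⇒flip x y a in suc s , cong (false ∷_) p
adjacent⇒flip (true ∷ x) (false ∷ y) a = zero , cong (false ∷_) (sym (distance-zero⇒≡ x y (cong pred a)))
adjacent⇒flip (false ∷ x) (true ∷ y) a = zero , cong (true ∷_) (sym (distance-zero⇒≡ x y (cong pred a)))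

flip-injective : ∀ {n} (x : Subset n) {s s' : Fin n} → flipAt x s ≡ flipAt x s' → s ≡ s'
flip-injective (b ∷ x) {zero} {zero} e = refl
flip-injective (true ∷ x) {zero} {suc s'} ()
flip-injective (false ∷ x) {zero} {suc s'} ()
flip-injective (true ∷ x) {suc s} {zero} ()
flip-injective (false ∷ x) {suc s} {zero} ()
flip-injective (b ∷ x) {suc s} {suc s'} e = cong suc (flip-injective x (cong tail e))

Partition : ∀ {H G : Graph} {T : Set} → (T → Embedding H G) → Set
Partition {G = G} {T} θ =
  ∀ x y → Adj G x y → Σ T λ i → InImage (θ i) x y × (∀ j → InImage (θ j) x y → j ≡ i)

partition-reindex : ∀ {H G : Graph} {S T : Set} (e : S ↔ T) (θ : T → Embedding H G) →
                    Partition θ → Partition (θ ∘ to e)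
partition-reindex e θ part x y a =
  let (i , im , unique) = part x y a in
  from e i ,
  subst (λ z → InImage (θ z) x y) (sym (strictlyInverseˡ e i)) im ,
  λ j imj → trans (sym (strictlyInverseʳ e j)) (cong (from e) (unique (to e j) imj))

divides-via : ∀ {H G : Graph} {T : Set} → Finite T → (θ : T → Embedding H G) →
              Partition θ → Divides H G
divides-via (r , e) θ part = r , θ ∘ to e , partition-reindex e θ part

divides-refl : ∀ {G : Graph} → Divides G G
divides-refl {G} = divides-via finite-⊤ (λ _ → identity) λ x y a → tt , (x , y , a , refl , refl) , λ _ _ → refl
  where
  identity : Embedding G G
  identity = record { map = λ u → u ; inj = λ e → e ; adj-pres = λ a → a }

divides-edgeless : ∀ {H G : Graph} → (∀ x y → ¬ Adj G x y) → Divides H G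
divides-edgeless no-edge = 0 , (λ ()) , λ x y a → ⊥-elim (no-edge x y a)

Q0-edgeless : ∀ x y → ¬ Adj (Q 0) x y
Q0-edgeless [] [] ()

module Glue {k m n : ℕ} {T U : Set}
  (θ : T → Embedding (Q k) (Q m)) (θ-part : Partition θ)
  (φ : U → Embedding (Q k) (Q n)) (φ-part : Partition φ) where

  glueʳ : T × Subset n → Embedding (Q k) (Q (m + n))
  glueʳ (i , y) = record
    { map = λ u → map (θ i) u ++ y
    ; inj = λ e → inj (θ i) (++-injectiveˡ _ _ e)
    ; adj-pres = λ {u} {v} a →
        trans (distance-++ (map (θ i) u) (map (θ i) v) y y) (cong₂ _+_ (adj-pres (θ i) a) (distance-self y)) }

  glueˡ : Subset m × U → Embedding (Q k) (Q (m + n))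
  glueˡ (x , j) = record
    { map = λ u → x ++ map (φ j) u
    ; inj = λ e → inj (φ j) (++-injectiveʳ x x e)
    ; adj-pres = λ {u} {v} a →
        trans (distance-++ x x (map (φ j) u) (map (φ j) v)) (cong₂ _+_ (distance-self x) (adj-pres (φ j) a)) }

  glued : (T × Subset n) ⊎ (Subset m × U) → Embedding (Q k) (Q (m + n))
  glued (inj₁ p) = glueʳ p
  glued (inj₂ p) = glueˡ p

  glueʳ-image : ∀ {i y} a₁ a₂ b₁ b₂ → InImage (glueʳ (i , y)) (a₁ ++ a₂) (b₁ ++ b₂) →
                InImage (θ i) a₁ b₁ × y ≡ a₂
  glueʳ-image a₁ a₂ b₁ b₂ (u , v , a , p , q) =
    (u , v , a , ++-injectiveˡ _ a₁ p , ++-injectiveˡ _ b₁ q) , ++-injectiveʳ _ a₁ p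

  glueˡ-image : ∀ {x j} a₁ a₂ b₁ b₂ → InImage (glueˡ (x , j)) (a₁ ++ a₂) (b₁ ++ b₂) →
                x ≡ a₁ × x ≡ b₁ × InImage (φ j) a₂ b₂
  glueˡ-image a₁ a₂ b₁ b₂ (u , v , a , p , q) =
    ++-injectiveˡ _ a₁ p , ++-injectiveˡ _ b₁ q ,
    (u , v , a , ++-injectiveʳ _ a₁ p , ++-injectiveʳ _ b₁ q)

  Owner : Subset (m + n) → Subset (m + n) → Set
  Owner a b = Σ _ λ i → InImage (glued i) a b × (∀ j → InImage (glued j) a b → j ≡ i)

  first-block : ∀ a₁ b₁ c → Adj (Q m) a₁ b₁ → Owner (a₁ ++ c) (b₁ ++ c)
  first-block a₁ b₁ c adj =
    let (i , (u , v , a , p , q) , unique) = θ-part a₁ b₁ adj in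
    inj₁ (i , c) , (u , v , a , cong (_++ c) p , cong (_++ c) q) , λ where
      (inj₁ (i' , y)) im → let (im' , y≡c) = glueʳ-image a₁ c b₁ c im in
                            cong₂ (λ i y → inj₁ (i , y)) (unique i' im') y≡c
      (inj₂ (x , j)) im → let (x≡a₁ , x≡b₁ , _) = glueˡ-image a₁ c b₁ c im in
                           ⊥-elim (adjacent-irreflexive adj (trans (sym x≡a₁) x≡b₁))

  second-block : ∀ c a₂ b₂ → Adj (Q n) a₂ b₂ → Owner (c ++ a₂) (c ++ b₂)
  second-block c a₂ b₂ adj =
    let (j , (u , v , a , p , q) , unique) = φ-part a₂ b₂ adj in
    inj₂ (c , j) , (u , v , a , cong (c ++_) p , cong (c ++_) q) , λ where
      (inj₁ (i , y)) im → let ((u' , v' , a' , p' , q') , y≡a₂) = glueʳ-image c a₂ c b₂ im in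
                           ⊥-elim (adjacent-irreflexive a' (inj (θ i) (trans p' (sym q'))))
      (inj₂ (x , j')) im → let (x≡c , _ , im') = glueˡ-image c a₂ c b₂ im in
                            cong₂ (λ x j → inj₂ (x , j)) x≡c (unique j' im')

  block-distances : ∀ {d₁ d₂} → d₁ + d₂ ≡ 1 → (d₁ ≡ 1 × d₂ ≡ 0) ⊎ (d₁ ≡ 0 × d₂ ≡ 1)
  block-distances {zero} e = inj₂ (refl , e)
  block-distances {suc zero} {zero} e = inj₁ (refl , refl)

  -- An edge of Q (m + n) changes exactly one of the two blocks.
  partition : Partition glued
  partition a b adj with splitAt m a | splitAt m b
  ... | a₁ , a₂ , refl | b₁ , b₂ , refl
    with block-distances (trans (sym (distance-++ a₁ b₁ a₂ b₂)) adj)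
  ... | inj₁ (adj₁ , same₂) =
    subst (λ c → Owner (a₁ ++ a₂) (b₁ ++ c)) (distance-zero⇒≡ a₂ b₂ same₂) (first-block a₁ b₁ a₂ adj₁)
  ... | inj₂ (same₁ , adj₂) =
    subst (λ c → Owner (a₁ ++ a₂) (c ++ b₂)) (distance-zero⇒≡ a₁ b₁ same₁) (second-block a₁ a₂ b₂ adj₂)

divides-+ : ∀ {k m n} → Divides (Q k) (Q m) → Divides (Q k) (Q n) → Divides (Q k) (Q (m + n))
divides-+ {m = m} {n} (r , θ , θ-part) (s , φ , φ-part) =
  divides-via index-finite (Glue.glued θ θ-part φ φ-part) (Glue.partition θ θ-part φ φ-part)
  where
  index-finite : Finite ((Fin r × Subset n) ⊎ (Subset m × Fin s))
  index-finite = finite-⊎ (finite-× (finite-Fin r) (finite-Subset n)) (finite-× (finite-Subset m) (finite-Fin s))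

divides-multiple : ∀ k q → Divides (Q k) (Q (q * k))
divides-multiple k zero = divides-edgeless Q0-edgeless
divides-multiple k (suc q) = divides-+ divides-refl (divides-multiple k q)

module Star {k n : ℕ} (θ : Embedding (Q k) (Q n)) {x : Subset n} where

  direction : ∀ {y} → InImage θ x y → Fin k
  direction (u , v , a , _) = proj₁ (adjacent⇒flip u v a)

  private
    direction-spec : ∀ {y} (w : InImage θ x y) → proj₁ (proj₂ w) ≡ flipAt (proj₁ w) (direction w)
    direction-spec (u , v , a , _) = proj₂ (adjacent⇒flip u v a)

    same-source : ∀ {y y'} (w : InImage θ x y) (w' : InImage θ x y') → proj₁ w ≡ proj₁ w'
    same-source (_ , _ , _ , p , _) (_ , _ , _ , p' , _) = inj θ (trans p (sym p'))

  direction-unique : ∀ {y} (w w' : InImage θ x y) → direction w ≡ direction w'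
  direction-unique w@(u , v , _ , _ , q) w'@(u' , v' , _ , _ , q') =
    flip-injective u (begin
      flipAt u (direction w)     ≡⟨ sym (direction-spec w) ⟩
      v                          ≡⟨ inj θ (trans q (sym q')) ⟩
      v'                         ≡⟨ direction-spec w' ⟩
      flipAt u' (direction w')   ≡⟨ cong (λ z → flipAt z (direction w')) (sym (same-source w w')) ⟩
      flipAt u (direction w')    ∎)
    where open ≡-Reasoning

  direction-injective : ∀ {y y'} (w : InImage θ x y) (w' : InImage θ x y') →
                        direction w ≡ direction w' → y ≡ y'
  direction-injective w@(u , v , _ , _ , q) w'@(u' , v' , _ , _ , q') same =
    trans (sym q) (trans (cong (map θ) v≡v') q')
    where
    v≡v' : v ≡ v'
    v≡v' = trans (direction-spec w) (trans (cong₂ flipAt (same-source w w') same) (sym (direction-spec w')))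

  direction-surjective : ∀ {y} (w : InImage θ x y) (s : Fin k) →
                         Σ (Subset n) λ y' → Σ (InImage θ x y') λ w' → direction w' ≡ s
  direction-surjective (u , _ , _ , p , _) s =
    map θ (flipAt u s) , (u , flipAt u s , flip-adjacent u s , p , refl) ,
    sym (flip-injective u (proj₂ (adjacent⇒flip u (flipAt u s) (flip-adjacent u s))))

  image-adjacent : ∀ {y} → InImage θ x y → Adj (Q n) x y
  image-adjacent (u , v , a , p , q) = subst₂ (Adj (Q n)) p q (adj-pres θ a)

module Labelling {k n r : ℕ} (θ : Fin r → Embedding (Q k) (Q n)) (θ-part : Partition θ)
  (x : Subset n) where

  open Star using (direction)

  Owner : Subset n → Set
  Owner y = Σ (Fin r) λ i → InImage (θ i) x y × (∀ j → InImage (θ j) x y → j ≡ i)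

  owner : ∀ t → Owner (flipAt x t)
  owner t = θ-part x (flipAt x t) (flip-adjacent x t)

  labelOf : ∀ {y} → Owner y → Fin r × Fin k
  labelOf (i , w , _) = i , direction (θ i) w

  label : Fin n → Fin r × Fin k
  label t = labelOf (owner t)

  label-from-copy : ∀ {i y} (w : InImage (θ i) x y) (o : Owner y) → labelOf o ≡ (i , direction (θ i) w)
  label-from-copy w (i' , w' , unique) with unique _ w
  ... | refl = cong (i' ,_) (Star.direction-unique (θ i') w' w)

  label-injective : ∀ {t t'} → label t ≡ label t' → t ≡ t'
  label-injective {t} {t'} same = flip-injective x (same-copy (owner t) (owner t') (cong proj₁ same) (cong proj₂ same))
    where
    same-copy : ∀ {y y'} (o : Owner y) (o' : Owner y') → proj₁ o ≡ proj₁ o' →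
                proj₂ (labelOf o) ≡ proj₂ (labelOf o') → y ≡ y'
    same-copy (i , w , _) (.i , w' , _) refl = Star.direction-injective (θ i) w w'

  rows-full : ∀ t s → Σ (Fin n) λ t' → label t' ≡ (proj₁ (label t) , s)
  rows-full t s = from-owner (owner t)
    where
    from-owner : ∀ {y} (o : Owner y) → Σ (Fin n) λ t' → label t' ≡ (proj₁ o , s)
    from-owner (i , w , _) with Star.direction-surjective (θ i) w s
    ... | y' , w' , dir with adjacent⇒flip x y' (Star.image-adjacent (θ i) w')
    ... | t' , refl = t' , trans (label-from-copy w' (owner t')) (cong (i ,_) dir)

divides⇒∣ : ∀ {k n} → Divides (Q k) (Q n) → k ∣ n
divides⇒∣ {n = n} (r , θ , θ-part) = RowCounting.k∣n label label-injective rows-full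
  where open Labelling θ θ-part (replicate n false)

-- The theorem.
proposition5 : (k n : ℕ) → 1 ≤ k → 1 ≤ n → (Divides (Q k) (Q n) ⇔ k ∣ n)
proposition5 k n _ _ = mk⇔ divides⇒∣ ∣⇒divides
  where
  ∣⇒divides : k ∣ n → Divides (Q k) (Q n)
  ∣⇒divides (divides q n≡q*k) = subst (Divides (Q k) ∘ Q) (sym n≡q*k) (divides-multiple k q)
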